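{- Let $G,H$ be finite simple undirected graphs of the same order and let $\ell\ge 1$ be an integer. Then \[ \delta_{(1)}(G,H)\ge \frac{\delta_{(1)}(G^{\odot \ell},H^{\odot \ell})}{\ell^2},\qquad \delta_{1}(G,H)\ge \frac{\delta_{1}(G^{\odot \ell},H^{\odot \ell})}{\ell},\qquad \delta_{\square}(G,H)\ge \frac{\delta_{\square}(G^{\odot \ell},H^{\odot \ell})}{\ell^2}. \]
   Context: For a graph $G$ with vertex set $V$, its adjacency matrix $A_G\in\{0,1\}^{V\times V}$ has $A_G(v,v')=1$ iff $vv'$ is an edge. For $A\in\mathbb{R}^{V\times V}$ and a bijection $\pi:V\to W$, $A^\pi\in\mathbb{R}^{W\times W}$ is given by $A^\pi(w,w')=A(\pi^{ -1}(w),\pi^{ -1}(w'))$. For $B\in\mathbb{R}^{I\times J}$: $\|B\|_{(1)}=\sum_{i,j}|B(i,j)|$; $\|B\|_1=\sup_{x\neq 0}\|Bx\|_1/\|x\|_1$ (operator 1-norm, with $\|x\|_1=\sum_j|x(j)|$); $\|B\|_\square=\max_{S\subseteq I,T\subseteq J}\big|\sum_{i\in S,j\in T}B(i,j)\big|$. For graphs $G=(V,E_G)$, $H=(W,E_H)$ of the same order, $\delta_{(1)}(G,H)=\min_\pi\|A_G^\pi-A_H\|_{(1)}$, $\delta_1(G,H)=\min_\pi\|A_G^\pi-A_H\|_1$, $\delta_\square(G,H)=\min_\pi\|A_G^\pi-A_H\|_\square$, minima over all bijections $\pi:V\to W$. The blow-up $G^{\odot \ell}$ is the graph with vertex set $V_G\times[\ell]$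 in which $(v,i)(w,j)$ is an edge iff $vw$ is an edge of $G$. -}

module Defs where

open import Data.Bool using (Bool; true; false)
open import Data.Nat as ℕ using (ℕ; zero; suc)
open import Data.Integer as ℤ using (ℤ; 0ℤ; 1ℤ)
open import Data.Rational as ℚ using (ℚ; 0ℚ)
open import Data.Fin using (Fin; zero; suc; quotient)
open import Data.Fin.Permutation using (Permutation′; _⟨$⟩ˡ_)
open import Data.Product using (Σ; _×_; _,_; ∃)
open import Relation.Binary.PropositionalEquality using (_≡_; _≢_)

record Graph (n : ℕ) : Set where
  field
    adj   : Fin n → Fin n → Bool
    sym   : ∀ u v → adj u v ≡ adj v u
    irrefl : ∀ v → adj v v ≡ false
open Graph public

-- Real matrices indexed by V × V are only ever needed with integer entries
-- (differences of 0/1 adjacency matrices).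
Mat : ℕ → Set
Mat n = Fin n → Fin n → ℤ

b2z : Bool → ℤ
b2z true  = 1ℤ
b2z false = 0ℤ

A : ∀ {n} → Graph n → Mat n
A G u v = b2z (adj G u v)

-- A^π (w , w') = A (π⁻¹ w , π⁻¹ w')
_^_ : ∀ {n} → Mat n → Permutation′ n → Mat n
(M ^ π) w w' = M (π ⟨$⟩ˡ w) (π ⟨$⟩ˡ w')

_-ᴹ_ : ∀ {n} → Mat n → Mat n → Mat n
(M -ᴹ N) i j = M i j ℤ.- N i j

sumℕ : ∀ {n} → (Fin n → ℕ) → ℕ
sumℕ {zero}  f = 0
sumℕ {suc n} f = f zero ℕ.+ sumℕ (λ i → f (suc i))

sumℤ : ∀ {n} → (Fin n → ℤ) → ℤ
sumℤ {zero}  f = 0ℤ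
sumℤ {suc n} f = f zero ℤ.+ sumℤ (λ i → f (suc i))

sumℚ : ∀ {n} → (Fin n → ℚ) → ℚ
sumℚ {zero}  f = 0ℚ
sumℚ {suc n} f = f zero ℚ.+ sumℚ (λ i → f (suc i))

norm⁽¹⁾ : ∀ {n} → Mat n → ℕ
norm⁽¹⁾ B = sumℕ (λ i → sumℕ (λ j → ℤ.∣ B i j ∣))

vnorm₁ : ∀ {n} → (Fin n → ℚ) → ℚ
vnorm₁ x = sumℚ (λ j → ℚ.∣ x j ∣)

_·_ : ∀ {n} → Mat n → (Fin n → ℚ) → (Fin n → ℚ)
(B · x) i = sumℚ (λ j → (B i j ℚ./ 1) ℚ.* x j)

IsOpBound₁ : ∀ {n} → Mat n → ℚ → Set
IsOpBound₁ B c = ∀ x → vnorm₁ (B · x) ℚ.≤ c ℚ.* vnorm₁ x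

IsOpNorm₁ : ∀ {n} → Mat n → ℚ → Set
IsOpNorm₁ B c = IsOpBound₁ B c × (∀ c' → IsOpBound₁ B c' → c ℚ.≤ c')

Subset : ℕ → Set
Subset n = Fin n → Bool

blockSum : ∀ {n} → Mat n → Subset n → Subset n → ℤ
blockSum B S T = sumℤ (λ i → sumℤ (λ j → b2z (S i) ℤ.* (b2z (T j) ℤ.* B i j)))

IsCutNorm : ∀ {n} → Mat n → ℕ → Set
IsCutNorm B c = (∀ S T → ℤ.∣ blockSum B S T ∣ ℕ.≤ c)
              × (∃ λ S → ∃ λ T → ℤ.∣ blockSum B S T ∣ ≡ c)

IsDist⁽¹⁾ : ∀ {n} → Graph n → Graph n → ℕ → Set
IsDist⁽¹⁾ G H d = (∃ λ π → norm⁽¹⁾ ((A G ^ π) -ᴹ A H) ≡ d)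
                × (∀ π → d ℕ.≤ norm⁽¹⁾ ((A G ^ π) -ᴹ A H))

IsDist₁ : ∀ {n} → Graph n → Graph n → ℚ → Set
IsDist₁ G H d = (∃ λ π → IsOpNorm₁ ((A G ^ π) -ᴹ A H) d)
              × (∀ π c → IsOpNorm₁ ((A G ^ π) -ᴹ A H) c → d ℚ.≤ c)

IsDist□ : ∀ {n} → Graph n → Graph n → ℕ → Set
IsDist□ G H d = (∃ λ π → IsCutNorm ((A G ^ π) -ᴹ A H) d)
              × (∀ π c → IsCutNorm ((A G ^ π) -ᴹ A H) c → d ℕ.≤ c)

-- Blow-up G^{⊙ℓ}: vertex set V × [ℓ], encoded as Fin (n * ℓ) via the
-- standard bijection Data.Fin.combine / remQuot; (v,i)(w,j) edge iff vw edge.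
blowup : ∀ {n} → Graph n → (ℓ : ℕ) → Graph (n ℕ.* ℓ)
blowup {n} G ℓ = record
  { adj    = λ x y → adj G (quotient ℓ x) (quotient ℓ y)
  ; sym    = λ x y → sym G (quotient ℓ x) (quotient ℓ y)
  ; irrefl = λ x → irrefl G (quotient ℓ x)
  }

{-# OPTIONS --safe #-}
module Submission where

-- Let π attain δ(G,H) and lift it to the permutation (v , i) ↦ (π v , i) of V × [ℓ]. The
-- difference matrix of the blow-ups at the lift is the blow-up M' of M = A_G^π − A_H, that is
-- M'((v,i),(w,j)) = M(v,w), and each norm of M' is computed by summing over the fibres of
-- V × [ℓ] → V. So ‖M'‖_(1) = ℓ²‖M‖_(1). A cut of M' splits into ℓ² cuts of M, one per pair
-- of layers, and the lift of an optimal cut of M attains ℓ² times its value, so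
-- ‖M'‖_□ = ℓ²‖M‖_□. Finally M'x is the lift of M applied to the fibre sums of x, which have
-- no larger 1-norm, and lifted vectors attain the bound, so ‖M'‖_1 = ℓ‖M‖_1. The distance
-- of the blow-ups is at most the norm at the lifted permutation.

open import Defs hiding (sym)
open import Algebra.Bundles using (Semiring; Ring)
open import Data.Fin.Base using (Fin; zero; suc; combine; quotient; _↑ˡ_; _↑ʳ_)
open import Data.Fin.Permutation using (Permutation′; _⟨$⟩ˡ_)
open import Data.Fin.Properties using (remQuot-combine; *↔×)
open import Data.Integer.Base as ℤ using (ℤ; +_)
import Data.Integer.Properties as ℤ
open import Data.Nat.Base as ℕ using (ℕ; zero; suc; _≥_)
import Data.Nat.Properties as ℕ
open import Data.Product.Base using (_×_; _,_; proj₁)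
open import Data.Product.Function.NonDependent.Propositional using (_×-↔_)
open import Data.Rational.Base as ℚ using (ℚ; 0ℚ; 1ℚ; _/_)
import Data.Rational.Properties as ℚ
import Data.Rational.Unnormalised.Base as ℚᵘ
import Data.Rational.Unnormalised.Properties as ℚᵘ
open import Function.Base using (_∘_)
open import Function.Construct.Identity using (↔-id)
open import Function.Properties.Inverse using (↔-sym; ↔-trans)
open import Relation.Binary.PropositionalEquality as ≡
  using (_≡_; refl; cong; cong₂; module ≡-Reasoning)
open import Relation.Nullary.Negation using (contradiction)

quotient-combine : ∀ {n ℓ} (v : Fin n) (i : Fin ℓ) → quotient ℓ (combine v i) ≡ v
quotient-combine v i = cong proj₁ (remQuot-combine v i)

module FinSum {a e} (R : Semiring a e) where

  open Semiring R hiding (zero)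

  -- Σ is any operator obeying the defining equations of the library's sum, and ι n stands
  -- for n × 1#, so that sumℕ, sumℤ and sumℚ inherit the library's summation lemmas.
  module Properties
    (Σ : ∀ {n} → (Fin n → Carrier) → Carrier)
    (Σ-zero : (f : Fin 0 → Carrier) → Σ f ≈ 0#)
    (Σ-suc : ∀ {n} (f : Fin (suc n) → Carrier) → Σ f ≈ f zero + Σ (f ∘ suc))
    (ι : ℕ → Carrier)
    (ι-zero : ι 0 ≈ 0#)
    (ι-suc : ∀ n → ι (suc n) ≈ 1# + ι n)
    where

    open import Algebra.Properties.Semiring.Sum R
      using (sum; sum-cong-≋; ∑-comm; *-distribˡ-sum)
    open import Relation.Binary.Reasoning.Setoid setoid

    Σ≈sum : ∀ {n} (f : Fin n → Carrier) → Σ f ≈ sum f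
    Σ≈sum {zero}  f = Σ-zero f
    Σ≈sum {suc n} f = trans (Σ-suc f) (+-congˡ (Σ≈sum (f ∘ suc)))

    Σ-cong : ∀ {n} {f g : Fin n → Carrier} → (∀ i → f i ≈ g i) → Σ f ≈ Σ g
    Σ-cong {f = f} {g} f≈g = begin
      Σ f   ≈⟨ Σ≈sum f ⟩
      sum f ≈⟨ sum-cong-≋ f≈g ⟩
      sum g ≈⟨ Σ≈sum g ⟨
      Σ g   ∎

    Σ-comm : ∀ {m n} (f : Fin m → Fin n → Carrier) →
             Σ (λ i → Σ (f i)) ≈ Σ (λ j → Σ (λ i → f i j))
    Σ-comm f = begin
      Σ (λ i → Σ (f i))             ≈⟨ Σ²≈sum² f ⟩
      sum (λ i → sum (f i))         ≈⟨ ∑-comm f ⟩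
      sum (λ j → sum (λ i → f i j)) ≈⟨ Σ²≈sum² (λ j i → f i j) ⟨
      Σ (λ j → Σ (λ i → f i j))     ∎
      where
      Σ²≈sum² : ∀ {m n} (g : Fin m → Fin n → Carrier) →
                Σ (λ i → Σ (g i)) ≈ sum (λ i → sum (g i))
      Σ²≈sum² g = trans (Σ≈sum _) (sum-cong-≋ (λ i → Σ≈sum (g i)))

    *-distribˡ-Σ : ∀ {n} x (f : Fin n → Carrier) → x * Σ f ≈ Σ (λ i → x * f i)
    *-distribˡ-Σ x f = begin
      x * Σ f             ≈⟨ *-congˡ (Σ≈sum f) ⟩
      x * sum f           ≈⟨ *-distribˡ-sum x f ⟩
      sum (λ i → x * f i) ≈⟨ Σ≈sum (λ i → x * f i) ⟨
      Σ (λ i → x * f i)   ∎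

    Σ-const : ∀ n x → Σ {n} (λ _ → x) ≈ ι n * x
    Σ-const zero    x = begin
      Σ {0} (λ _ → x) ≈⟨ Σ-zero _ ⟩
      0#              ≈⟨ zeroˡ x ⟨
      0# * x          ≈⟨ *-congʳ ι-zero ⟨
      ι 0 * x         ∎
    Σ-const (suc n) x = begin
      Σ {suc n} (λ _ → x) ≈⟨ Σ-suc _ ⟩
      x + Σ {n} (λ _ → x) ≈⟨ +-cong (sym (*-identityˡ x)) (Σ-const n x) ⟩
      1# * x + ι n * x    ≈⟨ distribʳ x 1# (ι n) ⟨
      (1# + ι n) * x      ≈⟨ *-congʳ (ι-suc n) ⟨
      ι (suc n) * x       ∎

    Σ-splitAt : ∀ m k (f : Fin (m ℕ.+ k) → Carrier) →
                Σ f ≈ Σ (λ i → f (i ↑ˡ k)) + Σ (λ j → f (m ↑ʳ j))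
    Σ-splitAt zero    k f = begin
      Σ f                        ≈⟨ +-identityˡ (Σ f) ⟨
      0# + Σ f                   ≈⟨ +-congʳ (Σ-zero _) ⟨
      Σ (λ i → f (i ↑ˡ k)) + Σ f ∎
    Σ-splitAt (suc m) k f = begin
      Σ f                                   ≈⟨ Σ-suc f ⟩
      f zero + Σ (f ∘ suc)                  ≈⟨ +-congˡ (Σ-splitAt m k (f ∘ suc)) ⟩
      f zero + (Σ f↑ˡ′ + Σ f↑ʳ)             ≈⟨ +-assoc _ _ _ ⟨
      (f zero + Σ f↑ˡ′) + Σ f↑ʳ             ≈⟨ +-congʳ (Σ-suc _) ⟨
      Σ (λ i → f (i ↑ˡ k)) + Σ f↑ʳ          ∎
      where
      f↑ˡ′ : Fin m → Carrier
      f↑ˡ′ i = f (suc (i ↑ˡ k))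
      f↑ʳ : Fin k → Carrier
      f↑ʳ j = f (suc m ↑ʳ j)

    Σ-combine : ∀ n ℓ (f : Fin (n ℕ.* ℓ) → Carrier) →
                Σ f ≈ Σ (λ (v : Fin n) → Σ (λ (i : Fin ℓ) → f (combine v i)))
    Σ-combine zero    ℓ f = trans (Σ-zero f) (sym (Σ-zero _))
    Σ-combine (suc n) ℓ f = begin
      Σ f                                                 ≈⟨ Σ-splitAt ℓ (n ℕ.* ℓ) f ⟩
      Σ (f ∘ combine₀) + Σ (λ x → f (ℓ ↑ʳ x))             ≈⟨ +-congˡ (Σ-combine n ℓ _) ⟩
      Σ (f ∘ combine₀) + Σ (λ v → Σ (λ i → f (combine (suc v) i))) ≈⟨ Σ-suc _ ⟨
      Σ (λ v → Σ (λ (i : Fin ℓ) → f (combine v i)))       ∎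
      where
      combine₀ : Fin ℓ → Fin (suc n ℕ.* ℓ)
      combine₀ = combine {suc n} zero

    Σ²-combine : ∀ n ℓ (f : Fin (n ℕ.* ℓ) → Fin (n ℕ.* ℓ) → Carrier) →
                 Σ (λ x → Σ (f x)) ≈
                 Σ (λ (i : Fin ℓ) → Σ (λ (j : Fin ℓ) →
                   Σ (λ (v : Fin n) → Σ (λ (w : Fin n) → f (combine v i) (combine w j)))))
    Σ²-combine n ℓ f = begin
      Σ (λ x → Σ (f x))                                 ≈⟨ Σ-combine n ℓ _ ⟩
      Σ (λ v → Σ (λ i → Σ (f (combine v i))))           ≈⟨ Σ-cong (λ v → Σ-cong (λ i → Σ-combine n ℓ _)) ⟩
      Σ (λ v → Σ (λ i → Σ (λ w → Σ (λ j → F v i w j)))) ≈⟨ Σ-cong (λ v → Σ-cong (λ i → Σ-comm (F v i))) ⟩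
      Σ (λ v → Σ (λ i → Σ (λ j → Σ (λ w → F v i w j)))) ≈⟨ Σ-comm _ ⟩
      Σ (λ i → Σ (λ v → Σ (λ j → Σ (λ w → F v i w j)))) ≈⟨ Σ-cong (λ i → Σ-comm _) ⟩
      Σ (λ i → Σ (λ j → Σ (λ v → Σ (λ w → F v i w j)))) ∎
      where
      F : Fin n → Fin ℓ → Fin n → Fin ℓ → Carrier
      F v i w j = f (combine v i) (combine w j)

    Σ-∘quotient : ∀ n ℓ (f : Fin n → Carrier) → Σ (f ∘ quotient {n} ℓ) ≈ ι ℓ * Σ f
    Σ-∘quotient n ℓ f = begin
      Σ (f ∘ quotient ℓ)                                         ≈⟨ Σ-combine n ℓ _ ⟩
      Σ (λ v → Σ (λ (i : Fin ℓ) → f (quotient ℓ (combine v i)))) ≈⟨ Σ-cong (λ v → Σ-cong (λ i →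
                                                                     reflexive (cong f (quotient-combine v i)))) ⟩
      Σ (λ v → Σ {ℓ} (λ _ → f v))                                ≈⟨ Σ-cong (λ v → Σ-const ℓ (f v)) ⟩
      Σ (λ v → ι ℓ * f v)                                        ≈⟨ *-distribˡ-Σ (ι ℓ) f ⟨
      ι ℓ * Σ f                                                  ∎

    Σ²-∘quotient : ∀ n ℓ (g : Fin n → Fin n → Carrier) →
                   Σ (λ x → Σ (λ y → g (quotient {n} ℓ x) (quotient {n} ℓ y))) ≈
                   ι ℓ * (ι ℓ * Σ (λ v → Σ (g v)))
    Σ²-∘quotient n ℓ g = begin
      Σ (λ x → Σ (λ y → g (quotient ℓ x) (quotient ℓ y))) ≈⟨ Σ-cong (λ x → Σ-∘quotient n ℓ _) ⟩
      Σ (λ x → ι ℓ * Σ (g (quotient ℓ x)))                ≈⟨ Σ-∘quotient n ℓ _ ⟩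
      ι ℓ * Σ (λ v → ι ℓ * Σ (g v))                       ≈⟨ *-congˡ (*-distribˡ-Σ (ι ℓ) _) ⟨
      ι ℓ * (ι ℓ * Σ (λ v → Σ (g v)))                     ∎

/1-suc : ∀ n → + suc n / 1 ≡ 1ℚ ℚ.+ + n / 1
/1-suc n = ℚ.toℚᵘ-injective (begin
  ℚ.toℚᵘ (+ suc n / 1)            ≈⟨ ℚ.toℚᵘ-fromℚᵘ (ℚᵘ.mkℚᵘ (+ suc n) 0) ⟩
  ℚᵘ.mkℚᵘ (+ suc n) 0             ≈⟨ ℚᵘ.*≡* (cong (λ m → (ℤ.1ℤ ℤ.+ m) ℤ.* + 1) (≡.sym (ℤ.*-identityʳ (+ n)))) ⟩
  ℚᵘ.1ℚᵘ ℚᵘ.+ ℚᵘ.mkℚᵘ (+ n) 0     ≈⟨ ℚᵘ.+-congʳ ℚᵘ.1ℚᵘ (ℚ.toℚᵘ-fromℚᵘ (ℚᵘ.mkℚᵘ (+ n) 0)) ⟨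
  ℚ.toℚᵘ 1ℚ ℚᵘ.+ ℚ.toℚᵘ (+ n / 1) ≈⟨ ℚ.toℚᵘ-homo-+ 1ℚ (+ n / 1) ⟨
  ℚ.toℚᵘ (1ℚ ℚ.+ + n / 1)         ∎)
  where open ℚᵘ.≃-Reasoning

module ℕΣ = FinSum.Properties ℕ.+-*-semiring sumℕ (λ _ → refl) (λ _ → refl) (λ m → m) refl (λ _ → refl)
module ℤΣ = FinSum.Properties ℤ.+-*-semiring sumℤ (λ _ → refl) (λ _ → refl) +_ refl (λ _ → refl)
module ℚΣ = FinSum.Properties (Ring.semiring ℚ.+-*-ring) sumℚ (λ _ → refl) (λ _ → refl) (λ m → + m / 1) refl /1-suc

∣sumℤ∣≤m*c : ∀ {m c} {f : Fin m → ℤ} → (∀ i → ℤ.∣ f i ∣ ℕ.≤ c) → ℤ.∣ sumℤ f ∣ ℕ.≤ m ℕ.* c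
∣sumℤ∣≤m*c {zero}  _ = ℕ.z≤n
∣sumℤ∣≤m*c {suc m} {f = f} ∣f∣≤c =
  ℕ.≤-trans (ℤ.∣i+j∣≤∣i∣+∣j∣ (f zero) _) (ℕ.+-mono-≤ (∣f∣≤c zero) (∣sumℤ∣≤m*c (∣f∣≤c ∘ suc)))

sumℚ-mono-≤ : ∀ {n} {f g : Fin n → ℚ} → (∀ i → f i ℚ.≤ g i) → sumℚ f ℚ.≤ sumℚ g
sumℚ-mono-≤ {zero}  _   = ℚ.≤-refl
sumℚ-mono-≤ {suc n} f≤g = ℚ.+-mono-≤ (f≤g zero) (sumℚ-mono-≤ (f≤g ∘ suc))

∣sumℚ∣≤vnorm₁ : ∀ {n} (f : Fin n → ℚ) → ℚ.∣ sumℚ f ∣ ℚ.≤ vnorm₁ f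
∣sumℚ∣≤vnorm₁ {zero}  f = ℚ.≤-refl
∣sumℚ∣≤vnorm₁ {suc n} f =
  ℚ.≤-trans (ℚ.∣p+q∣≤∣p∣+∣q∣ (f zero) _) (ℚ.+-monoʳ-≤ ℚ.∣ f zero ∣ (∣sumℚ∣≤vnorm₁ (f ∘ suc)))

vnorm₁-nonNeg : ∀ {n} (f : Fin n → ℚ) → 0ℚ ℚ.≤ vnorm₁ f
vnorm₁-nonNeg {zero}  f = ℚ.≤-refl
vnorm₁-nonNeg {suc n} f = ℚ.+-mono-≤ (ℚ.0≤∣p∣ (f zero)) (vnorm₁-nonNeg (f ∘ suc))

vnorm₁-*ˡ : ∀ {n} p (f : Fin n → ℚ) → vnorm₁ (λ i → p ℚ.* f i) ≡ ℚ.∣ p ∣ ℚ.* vnorm₁ f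
vnorm₁-*ˡ {n} p f = ≡.trans (ℚΣ.Σ-cong {n} (λ i → ℚ.∣p*q∣≡∣p∣*∣q∣ p (f i)))
                            (≡.sym (ℚΣ.*-distribˡ-Σ ℚ.∣ p ∣ (λ i → ℚ.∣ f i ∣)))

contract : ∀ {n} ℓ → (Fin (n ℕ.* ℓ) → ℚ) → Fin n → ℚ
contract ℓ x w = sumℚ (λ i → x (combine w i))

vnorm₁-contract : ∀ {n} ℓ (x : Fin (n ℕ.* ℓ) → ℚ) → vnorm₁ (contract {n} ℓ x) ℚ.≤ vnorm₁ x
vnorm₁-contract {n} ℓ x = begin
  vnorm₁ (contract {n} ℓ x)                                       ≤⟨ sumℚ-mono-≤ {n} (λ w → ∣sumℚ∣≤vnorm₁ {ℓ} _) ⟩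
  sumℚ (λ (w : Fin n) → vnorm₁ (λ (i : Fin ℓ) → x (combine w i))) ≡⟨ ℚΣ.Σ-combine n ℓ _ ⟨
  vnorm₁ x                                                        ∎
  where open ℚ.≤-Reasoning

isOpNorm₁⇒nonNeg : ∀ {n} {M : Mat n} {d} → IsOpNorm₁ M d → 0ℚ ℚ.≤ d
-- With no vertices every c is an operator bound, so none is least.
isOpNorm₁⇒nonNeg {zero} {d = d} (_ , least) = contradiction (ℚ.≤-<-trans d≤d-1 d-1<d) (ℚ.<-irrefl refl)
  where
  d≤d-1 : d ℚ.≤ d ℚ.- 1ℚ
  d≤d-1 = least (d ℚ.- 1ℚ) (λ _ → ℚ.≤-reflexive (≡.sym (ℚ.*-zeroʳ (d ℚ.- 1ℚ))))
  d-1<d : d ℚ.- 1ℚ ℚ.< d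
  d-1<d = ℚ.<-≤-trans (ℚ.+-monoʳ-< d (ℚ.negative⁻¹ (ℚ.- 1ℚ))) (ℚ.≤-reflexive (ℚ.+-identityʳ d))
isOpNorm₁⇒nonNeg {suc n} {M} {d} (bounded , _) = begin
  0ℚ              ≤⟨ vnorm₁-nonNeg (M · e₀) ⟩
  vnorm₁ (M · e₀) ≤⟨ bounded e₀ ⟩
  d ℚ.* vnorm₁ e₀ ≡⟨ cong (d ℚ.*_) ‖e₀‖≡1 ⟩
  d ℚ.* 1ℚ        ≡⟨ ℚ.*-identityʳ d ⟩
  d               ∎
  where
  open ℚ.≤-Reasoning
  e₀ : Fin (suc n) → ℚ
  e₀ zero    = 1ℚ
  e₀ (suc _) = 0ℚ
  ‖e₀‖≡1 : vnorm₁ e₀ ≡ 1ℚ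
  ‖e₀‖≡1 = cong (1ℚ ℚ.+_) (≡.trans (ℚΣ.Σ-const n 0ℚ) (ℚ.*-zeroʳ (+ n / 1)))

isOpNorm₁-least-scaled : ∀ {n} {M : Mat n} {d} → IsOpNorm₁ M d → ∀ k .{{_ : ℚ.Positive k}} c →
                         (∀ x → k ℚ.* vnorm₁ (M · x) ℚ.≤ c ℚ.* vnorm₁ x) → k ℚ.* d ℚ.≤ c
isOpNorm₁-least-scaled {M = M} {d} (_ , least) k c k‖Mx‖≤c‖x‖ = begin
  k ℚ.* d           ≤⟨ ℚ.*-monoˡ-≤-nonNeg k {{ℚ.pos⇒nonNeg k}} (least (1/k ℚ.* c) bounded) ⟩
  k ℚ.* (1/k ℚ.* c) ≡⟨ k*[1/k*c]≡c ⟩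
  c                 ∎
  where
  open ℚ.≤-Reasoning
  instance
    k≢0 : ℚ.NonZero k
    k≢0 = ℚ.pos⇒nonZero k
  1/k : ℚ
  1/k = ℚ.1/ k
  k*[1/k*c]≡c : k ℚ.* (1/k ℚ.* c) ≡ c
  k*[1/k*c]≡c = begin-equality
    k ℚ.* (1/k ℚ.* c) ≡⟨ ℚ.*-assoc k 1/k c ⟨
    (k ℚ.* 1/k) ℚ.* c ≡⟨ cong (ℚ._* c) (ℚ.*-inverseʳ k) ⟩
    1ℚ ℚ.* c          ≡⟨ ℚ.*-identityˡ c ⟩
    c                 ∎
  bounded : IsOpBound₁ M (1/k ℚ.* c)
  bounded x = ℚ.*-cancelˡ-≤-pos k (begin
    k ℚ.* vnorm₁ (M · x)             ≤⟨ k‖Mx‖≤c‖x‖ x ⟩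
    c ℚ.* vnorm₁ x                   ≡⟨ cong (ℚ._* vnorm₁ x) k*[1/k*c]≡c ⟨
    k ℚ.* (1/k ℚ.* c) ℚ.* vnorm₁ x   ≡⟨ ℚ.*-assoc k _ _ ⟩
    k ℚ.* (1/k ℚ.* c ℚ.* vnorm₁ x)   ∎)

blowupᴹ : ∀ {n} ℓ → Mat n → Mat (n ℕ.* ℓ)
blowupᴹ {n} ℓ M x y = M (quotient {n} ℓ x) (quotient {n} ℓ y)

infix 4 _≗ᴹ_
_≗ᴹ_ : ∀ {n} → Mat n → Mat n → Set
M ≗ᴹ N = ∀ i j → M i j ≡ N i j

slice : ∀ {n} ℓ → Subset (n ℕ.* ℓ) → Fin ℓ → Subset n
slice ℓ S i v = S (combine v i)

module _ {n ℓ} {M' : Mat (n ℕ.* ℓ)} {M : Mat n} (M'≗ : M' ≗ᴹ blowupᴹ ℓ M) where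

  norm⁽¹⁾-blowup : norm⁽¹⁾ M' ≡ (ℓ ℕ.* ℓ) ℕ.* norm⁽¹⁾ M
  norm⁽¹⁾-blowup = begin
    norm⁽¹⁾ M'                                               ≡⟨ ℕΣ.Σ-cong (λ x → ℕΣ.Σ-cong (λ y → cong ℤ.∣_∣ (M'≗ x y))) ⟩
    sumℕ (λ x → sumℕ (λ y → ℤ.∣ blowupᴹ ℓ M x y ∣))          ≡⟨ ℕΣ.Σ²-∘quotient n ℓ (λ v w → ℤ.∣ M v w ∣) ⟩
    ℓ ℕ.* (ℓ ℕ.* norm⁽¹⁾ M)                                  ≡⟨ ℕ.*-assoc ℓ ℓ _ ⟨
    (ℓ ℕ.* ℓ) ℕ.* norm⁽¹⁾ M                                  ∎
    where open ≡-Reasoning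

  blockSum-blowup : ∀ S T →
    blockSum M' S T ≡ sumℤ (λ i → sumℤ (λ j → blockSum M (slice ℓ S i) (slice ℓ T j)))
  blockSum-blowup S T = ≡.trans (ℤΣ.Σ²-combine n ℓ _)
    (ℤΣ.Σ-cong λ i → ℤΣ.Σ-cong λ j → ℤΣ.Σ-cong λ v → ℤΣ.Σ-cong λ w →
      cong (λ m → b2z (S (combine v i)) ℤ.* (b2z (T (combine w j)) ℤ.* m))
           (≡.trans (M'≗ (combine v i) (combine w j)) (cong₂ M (quotient-combine v i) (quotient-combine w j))))

  blockSum-blowup-∘quotient : ∀ S T →
    blockSum M' (S ∘ quotient ℓ) (T ∘ quotient ℓ) ≡ + ℓ ℤ.* (+ ℓ ℤ.* blockSum M S T)
  blockSum-blowup-∘quotient S T = ≡.trans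
    (ℤΣ.Σ-cong λ x → ℤΣ.Σ-cong λ y →
      cong (λ m → b2z (S (quotient ℓ x)) ℤ.* (b2z (T (quotient ℓ y)) ℤ.* m)) (M'≗ x y))
    (ℤΣ.Σ²-∘quotient n ℓ (λ v w → b2z (S v) ℤ.* (b2z (T w) ℤ.* M v w)))

  isCutNorm-blowup : ∀ {c} → IsCutNorm M c → IsCutNorm M' ((ℓ ℕ.* ℓ) ℕ.* c)
  isCutNorm-blowup {c} (bounded , S , T , attained) =
    bounded' , S ∘ quotient ℓ , T ∘ quotient ℓ , attained'
    where
    bounded' : ∀ S' T' → ℤ.∣ blockSum M' S' T' ∣ ℕ.≤ (ℓ ℕ.* ℓ) ℕ.* c
    bounded' S' T' = begin
      ℤ.∣ blockSum M' S' T' ∣     ≡⟨ cong ℤ.∣_∣ (blockSum-blowup S' T') ⟩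
      ℤ.∣ sumℤ (λ i → sumℤ (λ j → blockSum M (slice ℓ S' i) (slice ℓ T' j))) ∣
                                  ≤⟨ ∣sumℤ∣≤m*c {ℓ} (λ i → ∣sumℤ∣≤m*c {ℓ} (λ j →
                                       bounded (slice ℓ S' i) (slice ℓ T' j))) ⟩
      ℓ ℕ.* (ℓ ℕ.* c)             ≡⟨ ℕ.*-assoc ℓ ℓ c ⟨
      (ℓ ℕ.* ℓ) ℕ.* c             ∎
      where open ℕ.≤-Reasoning
    attained' : ℤ.∣ blockSum M' (S ∘ quotient ℓ) (T ∘ quotient ℓ) ∣ ≡ (ℓ ℕ.* ℓ) ℕ.* c
    attained' = begin
      ℤ.∣ blockSum M' (S ∘ quotient ℓ) (T ∘ quotient ℓ) ∣ ≡⟨ cong ℤ.∣_∣ (blockSum-blowup-∘quotient S T) ⟩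
      ℤ.∣ + ℓ ℤ.* (+ ℓ ℤ.* blockSum M S T) ∣              ≡⟨ ℤ.abs-* (+ ℓ) _ ⟩
      ℓ ℕ.* ℤ.∣ + ℓ ℤ.* blockSum M S T ∣                  ≡⟨ cong (ℓ ℕ.*_) (ℤ.abs-* (+ ℓ) _) ⟩
      ℓ ℕ.* (ℓ ℕ.* ℤ.∣ blockSum M S T ∣)                  ≡⟨ ℕ.*-assoc ℓ ℓ _ ⟨
      (ℓ ℕ.* ℓ) ℕ.* ℤ.∣ blockSum M S T ∣                  ≡⟨ cong ((ℓ ℕ.* ℓ) ℕ.*_) attained ⟩
      (ℓ ℕ.* ℓ) ℕ.* c                                     ∎
      where open ≡-Reasoning

  ·-blowup : ∀ x z → (M' · x) z ≡ (M · contract ℓ x) (quotient ℓ z)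
  ·-blowup x z = begin
    (M' · x) z                                             ≡⟨ ℚΣ.Σ-combine n ℓ _ ⟩
    sumℚ (λ w → sumℚ (λ i → row′ w i ℚ.* x (combine w i))) ≡⟨ ℚΣ.Σ-cong (λ w → ℚΣ.Σ-cong (λ i →
                                                                cong (ℚ._* x (combine w i)) (row′≡row w i))) ⟩
    sumℚ (λ w → sumℚ (λ i → row w ℚ.* x (combine w i)))    ≡⟨ ℚΣ.Σ-cong {n} (λ w → ℚΣ.*-distribˡ-Σ {ℓ} (row w) _) ⟨
    (M · contract ℓ x) (quotient ℓ z)                      ∎
    where
    open ≡-Reasoning
    row′ : Fin n → Fin ℓ → ℚ
    row′ w i = M' z (combine w i) / 1
    row : Fin n → ℚ
    row w = M (quotient ℓ z) w / 1
    row′≡row : ∀ w i → row′ w i ≡ row w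
    row′≡row w i = cong (λ m → m / 1)
      (≡.trans (M'≗ z (combine w i)) (cong (M (quotient ℓ z)) (quotient-combine w i)))

  ·-blowup-∘quotient : ∀ x z → (M' · (x ∘ quotient ℓ)) z ≡ (+ ℓ / 1) ℚ.* (M · x) (quotient ℓ z)
  ·-blowup-∘quotient x z = ≡.trans
    (ℚΣ.Σ-cong (λ y → cong (λ m → (m / 1) ℚ.* x (quotient ℓ y)) (M'≗ z y)))
    (ℚΣ.Σ-∘quotient n ℓ (λ w → (M (quotient ℓ z) w / 1) ℚ.* x w))

  isOpNorm₁-blowup : ∀ {d} .{{_ : ℕ.NonZero ℓ}} → IsOpNorm₁ M d → IsOpNorm₁ M' ((+ ℓ / 1) ℚ.* d)
  isOpNorm₁-blowup {d} M-norm@(bounded , _) = bounded' , least'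
    where
    L : ℚ
    L = + ℓ / 1
    instance
      L-pos : ℚ.Positive L
      L-pos = ℚ.normalize-pos ℓ 1
      L-nonNeg : ℚ.NonNegative L
      L-nonNeg = ℚ.pos⇒nonNeg L
      d-nonNeg : ℚ.NonNegative d
      d-nonNeg = ℚ.nonNegative (isOpNorm₁⇒nonNeg {M = M} M-norm)
    open ℚ.≤-Reasoning
    bounded' : IsOpBound₁ M' (L ℚ.* d)
    bounded' x = begin
      vnorm₁ (M' · x)                          ≡⟨ ℚΣ.Σ-cong (λ z → cong ℚ.∣_∣ (·-blowup x z)) ⟩
      vnorm₁ ((M · contract ℓ x) ∘ quotient ℓ) ≡⟨ ℚΣ.Σ-∘quotient n ℓ _ ⟩
      L ℚ.* vnorm₁ (M · contract ℓ x)          ≤⟨ ℚ.*-monoˡ-≤-nonNeg L (bounded (contract ℓ x)) ⟩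
      L ℚ.* (d ℚ.* vnorm₁ (contract {n} ℓ x))  ≤⟨ ℚ.*-monoˡ-≤-nonNeg L (ℚ.*-monoˡ-≤-nonNeg d (vnorm₁-contract {n} ℓ x)) ⟩
      L ℚ.* (d ℚ.* vnorm₁ x)                   ≡⟨ ℚ.*-assoc L d _ ⟨
      L ℚ.* d ℚ.* vnorm₁ x                     ∎
    least' : ∀ c → IsOpBound₁ M' c → L ℚ.* d ℚ.≤ c
    least' c c-bounded = isOpNorm₁-least-scaled {M = M} M-norm L c (λ x → ℚ.*-cancelˡ-≤-pos L (begin
      L ℚ.* (L ℚ.* vnorm₁ (M · x))                ≡⟨ cong (λ p → L ℚ.* (p ℚ.* vnorm₁ (M · x)))
                                                          (ℚ.0≤p⇒∣p∣≡p (ℚ.nonNegative⁻¹ L)) ⟨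
      L ℚ.* (ℚ.∣ L ∣ ℚ.* vnorm₁ (M · x))          ≡⟨ cong (L ℚ.*_) (vnorm₁-*ˡ L (M · x)) ⟨
      L ℚ.* vnorm₁ (λ w → L ℚ.* (M · x) w)        ≡⟨ ℚΣ.Σ-∘quotient n ℓ _ ⟨
      vnorm₁ (λ z → L ℚ.* (M · x) (quotient ℓ z)) ≡⟨ ℚΣ.Σ-cong (λ z → cong ℚ.∣_∣ (·-blowup-∘quotient x z)) ⟨
      vnorm₁ (M' · (x ∘ quotient ℓ))              ≤⟨ c-bounded (x ∘ quotient ℓ) ⟩
      c ℚ.* vnorm₁ (x ∘ quotient ℓ)               ≡⟨ cong (c ℚ.*_) (ℚΣ.Σ-∘quotient n ℓ _) ⟩
      c ℚ.* (L ℚ.* vnorm₁ x)                      ≡⟨ ℚ.*-assoc c L _ ⟨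
      c ℚ.* L ℚ.* vnorm₁ x                        ≡⟨ cong (ℚ._* vnorm₁ x) (ℚ.*-comm c L) ⟩
      L ℚ.* c ℚ.* vnorm₁ x                        ≡⟨ ℚ.*-assoc L c _ ⟩
      L ℚ.* (c ℚ.* vnorm₁ x)                      ∎))

liftPerm : ∀ {n} ℓ → Permutation′ n → Permutation′ (n ℕ.* ℓ)
liftPerm ℓ π = ↔-trans *↔× (↔-trans (π ×-↔ ↔-id _) (↔-sym *↔×))

quotient-liftPerm : ∀ {n} ℓ (π : Permutation′ n) x →
                    quotient ℓ (liftPerm ℓ π ⟨$⟩ˡ x) ≡ π ⟨$⟩ˡ quotient ℓ x
quotient-liftPerm ℓ π x = quotient-combine _ _

Δ : ∀ {n} → Graph n → Graph n → Permutation′ n → Mat n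
Δ G H π = (A G ^ π) -ᴹ A H

Δ-blowup : ∀ {n} (G H : Graph n) ℓ π →
           Δ (blowup G ℓ) (blowup H ℓ) (liftPerm ℓ π) ≗ᴹ blowupᴹ ℓ (Δ G H π)
Δ-blowup G H ℓ π x y = cong₂ (λ v w → A G v w ℤ.- A H (quotient ℓ x) (quotient ℓ y))
                             (quotient-liftPerm ℓ π x) (quotient-liftPerm ℓ π y)

dist⁽¹⁾-blowup-≤ : ∀ {n} (G H : Graph n) ℓ {d d'} → IsDist⁽¹⁾ G H d →
                   IsDist⁽¹⁾ (blowup G ℓ) (blowup H ℓ) d' → d' ℕ.≤ (ℓ ℕ.* ℓ) ℕ.* d
dist⁽¹⁾-blowup-≤ G H ℓ {d} {d'} ((π , ‖Δ‖≡d) , _) (_ , d'-least) = begin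
  d'                                                   ≤⟨ d'-least (liftPerm ℓ π) ⟩
  norm⁽¹⁾ (Δ (blowup G ℓ) (blowup H ℓ) (liftPerm ℓ π)) ≡⟨ norm⁽¹⁾-blowup {M = Δ G H π} (Δ-blowup G H ℓ π) ⟩
  (ℓ ℕ.* ℓ) ℕ.* norm⁽¹⁾ (Δ G H π)                      ≡⟨ cong ((ℓ ℕ.* ℓ) ℕ.*_) ‖Δ‖≡d ⟩
  (ℓ ℕ.* ℓ) ℕ.* d                                      ∎
  where open ℕ.≤-Reasoning

dist₁-blowup-≤ : ∀ {n} (G H : Graph n) ℓ .{{_ : ℕ.NonZero ℓ}} {d d'} → IsDist₁ G H d →
                 IsDist₁ (blowup G ℓ) (blowup H ℓ) d' → d' ℚ.≤ (+ ℓ / 1) ℚ.* d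
dist₁-blowup-≤ G H ℓ ((π , Δ-norm) , _) (_ , d'-least) =
  d'-least (liftPerm ℓ π) _ (isOpNorm₁-blowup {M = Δ G H π} (Δ-blowup G H ℓ π) Δ-norm)

dist□-blowup-≤ : ∀ {n} (G H : Graph n) ℓ {d d'} → IsDist□ G H d →
                 IsDist□ (blowup G ℓ) (blowup H ℓ) d' → d' ℕ.≤ (ℓ ℕ.* ℓ) ℕ.* d
dist□-blowup-≤ G H ℓ ((π , Δ-cut) , _) (_ , d'-least) =
  d'-least (liftPerm ℓ π) _ (isCutNorm-blowup {M = Δ G H π} (Δ-blowup G H ℓ π) Δ-cut)

lemma3p5 : ∀ {n} (G H : Graph n) (ℓ : ℕ) → ℓ ≥ 1 →
      (∀ d d' → IsDist⁽¹⁾ G H d → IsDist⁽¹⁾ (blowup G ℓ) (blowup H ℓ) d' →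
          d' ℕ.≤ (ℓ ℕ.* ℓ) ℕ.* d)
    × (∀ d d' → IsDist₁ G H d → IsDist₁ (blowup G ℓ) (blowup H ℓ) d' →
          d' ℚ.≤ (ℤ.+ ℓ ℚ./ 1) ℚ.* d)
    × (∀ d d' → IsDist□ G H d → IsDist□ (blowup G ℓ) (blowup H ℓ) d' →
          d' ℕ.≤ (ℓ ℕ.* ℓ) ℕ.* d)
lemma3p5 G H ℓ ℓ≥1 =
    (λ _ _ → dist⁽¹⁾-blowup-≤ G H ℓ)
  , (λ _ _ → dist₁-blowup-≤ G H ℓ {{ℕ.>-nonZero ℓ≥1}})
  , (λ _ _ → dist□-blowup-≤ G H ℓ)
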